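{- Let $p>3$ be a prime, $k=2$, $e\ge1$, and $l_1,l_2$ non-negative integers. Then $D_{p^{l_1}+p^{l_2},2}(1,x)$ is not a permutation polynomial of $\mathbb{F}_{p^e}$.
   Context: For an odd prime $p$ and $0\le k\le p-1$: for $n\ge 1$, $D_{n,k}(1,x)=\sum_{i=0}^{\lfloor n/2\rfloor}\frac{n-ki}{n-i}\binom{n-i}{i}(-x)^i$, where the coefficient is the integer $\binom{n-i}{i}-(k-1)\binom{n-i-1}{i-1}$ (with $\binom{m}{ -1}=0$) viewed in $\mathbb{F}_p$; $D_{0,k}(1,x)=2-k$. Equivalently $D_{1,k}=1$ and $D_{n,k}=D_{n-1,k}-xD_{n-2,k}$ for $n\ge2$. A polynomial over $\mathbb{F}_q$ is a permutation polynomial of $\mathbb{F}_q$ if it induces a bijection of $\mathbb{F}_q$. -}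

module Defs where

open import Level using (Level; _⊔_)
open import Data.Nat using (ℕ; zero; suc)
open import Data.Fin using (Fin)
open import Data.Product using (Σ; _×_)
open import Relation.Nullary using (¬_)
open import Algebra.Bundles using (CommutativeRing)
open import Function.Bundles using (Inverse)
import Relation.Binary.PropositionalEquality as ≡

module _ {c ℓ : Level} (R : CommutativeRing c ℓ) where
  open CommutativeRing R

  ι : ℕ → Carrier
  ι zero    = 0#
  ι (suc n) = 1# + ι n

  IsField : Set (c ⊔ ℓ)
  IsField = (¬ (1# ≈ 0#)) × (∀ x → ¬ (x ≈ 0#) → Σ Carrier (λ y → (x * y) ≈ 1#))

  HasCard : ℕ → Set (c ⊔ ℓ)
  HasCard n = Inverse (≡.setoid (Fin n)) setoid

  -- Dickson polynomial of the (k+1)-th kind D_{n,k}(1,x), evaluated at x,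
  -- via D_0 = 2 - k, D_1 = 1, D_n = D_{n-1} - x D_{n-2}
  D : ℕ → ℕ → Carrier → Carrier
  D zero          k x = ι 2 - ι k
  D (suc zero)    k x = 1#
  D (suc (suc n)) k x = D (suc n) k x - (x * D n k x)

  IsPermutation : (Carrier → Carrier) → Set (c ⊔ ℓ)
  IsPermutation f = (∀ x y → f x ≈ f y → x ≈ y) × (∀ y → Σ Carrier (λ x → f x ≈ y))

module Submission where

-- A finite field F of order pᵉ, p > 3 prime, has characteristic p.  Put
-- n = pᵃ + pᵇ; we show that D_{n,2}(1,x) takes the same value 1 at x = 0 and at
-- x = -2, two distinct points since 2 ≠ 0 in F, so it is not injective.
--
-- * At x = 0 the recurrence D_{m+2} = D_{m+1} - x D_m collapses to D_m = 1 (m ≥ 1).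
-- * At x = -2 it becomes the Jacobsthal recurrence, so D_m(-2) is the image of
--   the Jacobsthal number J_m, and 3 J_m + 1 = 2^m for even m.  As p is odd, n
--   is even, and Fermat's little theorem 2^p ≡ 2 (mod p) gives 2ⁿ = 2·2 = 4 in F;
--   hence 3 D_n(-2) = 3, and D_n(-2) = 1 because 3 ≠ 0 in F.
--
-- Since equality in F need not be decidable, the characteristic
-- is obtained in doubly negated form, which suffices for a negative conclusion.

open import Defs
open import Level using (Level)
open import Data.Nat using (ℕ; _+_; _^_; _<_; _≤_)
open import Data.Nat.Primality using (Prime)
open import Relation.Nullary using (¬_)
open import Algebra.Bundles using (CommutativeRing)

open import Data.Nat using (zero; suc; _*_)
open import Data.Nat.Properties using (n<1+n; <-trans)
open import Data.Nat.GCD using (module Bézout)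
open import Data.Nat.Coprimality using (coprime-Bézout; prime⇒coprime)
open import Data.Fin.Permutation using (Permutation; permutation)
open import Data.Vec.Functional using (replicate)
open import Data.Product using (_,_)
open import Function.Bundles using (Inverse)
import Relation.Binary.PropositionalEquality as ≡

module Arithmetic where
  open import Data.Nat using (s≤s)
  open import Data.Nat.Properties
  open import Data.Nat.Divisibility using (_∣_; divides; ∣⇒≤)
  open import Data.Nat.Primality using (euclidsLemma; prime⇒irreducible)
  open import Data.Nat.Tactic.RingSolver using (solve-∀)
  open import Data.Product using (∃)
  open import Data.Sum using (_⊎_; inj₁; inj₂)
  open import Relation.Nullary using (contradiction)
  open import Relation.Binary.PropositionalEquality
  open ≡-Reasoning

  choose : ℕ → ℕ → ℕ
  choose zero    zero    = 1
  choose zero    (suc k) = 0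
  choose (suc n) zero    = 1
  choose (suc n) (suc k) = choose n k + choose n (suc k)

  choose-over : ∀ n k → n < k → choose n k ≡ 0
  choose-over zero    (suc k) _         = refl
  choose-over (suc n) (suc k) (s≤s n<k)
    rewrite choose-over n k n<k | choose-over n (suc k) (m<n⇒m<1+n n<k) = refl

  choose-diag : ∀ n → choose n n ≡ 1
  choose-diag zero    = refl
  choose-diag (suc n) rewrite choose-diag n | choose-over n (suc n) (n<1+n n) = refl

  choose-zero : ∀ n → choose n 0 ≡ 1
  choose-zero zero    = refl
  choose-zero (suc n) = refl

  choose-one : ∀ n → choose n 1 ≡ n
  choose-one zero    = refl
  choose-one (suc n) = cong₂ _+_ (choose-zero n) (choose-one n)

  absorption : ∀ n k → suc k * choose (suc n) (suc k) ≡ suc n * choose n k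
  absorption zero    zero    = refl
  absorption zero    (suc k) = *-zeroʳ (suc (suc k))
  absorption (suc n) zero    = begin
    1 * (1 + choose (suc n) 1)  ≡⟨ cong (λ c → 1 * (1 + c)) (choose-one (suc n)) ⟩
    1 * suc (suc n)             ≡⟨ *-comm 1 (suc (suc n)) ⟩
    suc (suc n) * 1             ∎
  absorption (suc n) (suc k) = begin
    suc (suc k) * (a + b)                 ≡⟨ regroup (suc k) a b ⟩
    a + (suc k * a + suc (suc k) * b)
      ≡⟨ cong₂ (λ u v → a + (u + v)) (absorption n k) (absorption n (suc k)) ⟩
    a + (suc n * choose n k + suc n * choose n (suc k))
      ≡⟨ cong (a +_) (sym (*-distribˡ-+ (suc n) (choose n k) (choose n (suc k)))) ⟩
    suc (suc n) * a                       ∎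
    where
    a b : ℕ
    a = choose (suc n) (suc k)
    b = choose (suc n) (suc (suc k))
    regroup : ∀ k a b → suc k * (a + b) ≡ a + (k * a + suc k * b)
    regroup = solve-∀

  prime∣choose : ∀ {p} → Prime p → ∀ j → suc j < p → p ∣ choose p (suc j)
  prime∣choose {suc q} p-prime j j<q
    with euclidsLemma (suc j) (choose (suc q) (suc j)) p-prime
           (divides (choose q j) (trans (absorption q j) (*-comm (suc q) (choose q j))))
  ... | inj₁ p∣suc-j = contradiction (∣⇒≤ p∣suc-j) (<⇒≱ j<q)
  ... | inj₂ p∣choose = p∣choose

  rowSum : ℕ → ℕ → ℕ
  rowSum n zero    = 0
  rowSum n (suc m) = rowSum n m + choose n m

  rowSum-pascal : ∀ n m → rowSum (suc n) (suc m) ≡ rowSum n (suc m) + rowSum n m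
  rowSum-pascal n zero    = sym (trans (+-identityʳ (choose n 0)) (choose-zero n))
  rowSum-pascal n (suc m) = begin
    rowSum (suc n) (suc m) + (choose n m + choose n (suc m))
      ≡⟨ cong (_+ (choose n m + choose n (suc m))) (rowSum-pascal n m) ⟩
    rowSum n (suc m) + rowSum n m + (choose n m + choose n (suc m))
      ≡⟨ regroup (rowSum n m) (choose n m) (choose n (suc m)) ⟩
    rowSum n m + choose n m + choose n (suc m) + (rowSum n m + choose n m) ∎
    where
    regroup : ∀ s a b → s + a + s + (a + b) ≡ s + a + b + (s + a)
    regroup = solve-∀

  rowSum-full : ∀ n → rowSum n (suc n) ≡ 2 ^ n
  rowSum-full zero    = refl
  rowSum-full (suc n) = begin
    rowSum (suc n) (suc (suc n))                         ≡⟨ rowSum-pascal n (suc n) ⟩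
    rowSum n (suc n) + choose n (suc n) + rowSum n (suc n)
      ≡⟨ cong (λ c → rowSum n (suc n) + c + rowSum n (suc n)) (choose-over n (suc n) (n<1+n n)) ⟩
    rowSum n (suc n) + 0 + rowSum n (suc n)              ≡⟨ cong (λ s → s + 0 + s) (rowSum-full n) ⟩
    2 ^ n + 0 + 2 ^ n                                    ≡⟨ double (2 ^ n) ⟩
    2 * 2 ^ n                                            ∎
    where
    double : ∀ x → x + 0 + x ≡ 2 * x
    double = solve-∀

  rowSum-prime : ∀ {p} → Prime p → ∀ j → j < p → ∃ λ c → rowSum p (suc j) ≡ 1 + c * p
  rowSum-prime {suc q} p-prime zero    _     = 0 , refl
  rowSum-prime {p}     p-prime (suc j) j<p
    with rowSum-prime p-prime j (<-trans (n<1+n j) j<p) | prime∣choose p-prime j j<p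
  ... | c , sum≡ | divides d choose≡ = c + d , (begin
    rowSum p (suc j) + choose p (suc j) ≡⟨ cong₂ _+_ sum≡ choose≡ ⟩
    1 + c * p + d * p                   ≡⟨ collect c d p ⟩
    1 + (c + d) * p                     ∎)
    where
    collect : ∀ c d p → 1 + c * p + d * p ≡ 1 + (c + d) * p
    collect = solve-∀

  fermat-two : ∀ {p} → Prime p → ∃ λ c → 2 ^ p ≡ 2 + c * p
  fermat-two {suc q} p-prime with rowSum-prime p-prime q (n<1+n q)
  ... | c , sum≡ = c , (begin
    2 ^ suc q                                  ≡⟨ rowSum-full (suc q) ⟨
    rowSum (suc q) (suc q) + choose (suc q) (suc q) ≡⟨ cong₂ _+_ sum≡ (choose-diag (suc q)) ⟩
    1 + c * suc q + 1                          ≡⟨ +-comm (1 + c * suc q) 1 ⟩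
    2 + c * suc q                              ∎)

  Odd : ℕ → Set
  Odd n = ∃ λ k → n ≡ 1 + 2 * k

  even-or-odd : ∀ n → ∃ λ k → n ≡ 2 * k ⊎ n ≡ 1 + 2 * k
  even-or-odd zero = 0 , inj₁ refl
  even-or-odd (suc n) with even-or-odd n
  ... | k , inj₁ n≡2k   = k , inj₂ (cong suc n≡2k)
  ... | k , inj₂ n≡2k+1 = suc k , inj₁ (trans (cong suc n≡2k+1) (step k))
    where
    step : ∀ k → 2 + 2 * k ≡ 2 * suc k
    step = solve-∀

  prime⇒odd : ∀ {p} → Prime p → 2 < p → Odd p
  prime⇒odd {p} p-prime 2<p with even-or-odd p
  ... | k , inj₂ p≡2k+1 = k , p≡2k+1
  ... | k , inj₁ p≡2k with prime⇒irreducible p-prime (divides k (trans p≡2k (*-comm 2 k)))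
  ...   | inj₁ ()
  ...   | inj₂ 2≡p = contradiction (sym 2≡p) (>⇒≢ 2<p)

  odd-^ : ∀ {p} → Odd p → ∀ a → Odd (p ^ a)
  odd-^ _ zero = 0 , refl
  odd-^ {p} (k , p≡) (suc a) with odd-^ (k , p≡) a
  ... | j , pᵃ≡ = k + j + 2 * k * j , (begin
    p * p ^ a                   ≡⟨ cong₂ _*_ p≡ pᵃ≡ ⟩
    (1 + 2 * k) * (1 + 2 * j)   ≡⟨ expand k j ⟩
    1 + 2 * (k + j + 2 * k * j) ∎)
    where
    expand : ∀ k j → (1 + 2 * k) * (1 + 2 * j) ≡ 1 + 2 * (k + j + 2 * k * j)
    expand = solve-∀

  odd+odd : ∀ {m n} → Odd m → Odd n → ∃ λ h → m + n ≡ suc h + suc h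
  odd+odd {m} {n} (k , m≡) (j , n≡) = k + j , (begin
    m + n                         ≡⟨ cong₂ _+_ m≡ n≡ ⟩
    1 + 2 * k + (1 + 2 * j)       ≡⟨ halve k j ⟩
    suc (k + j) + suc (k + j)     ∎)
    where
    halve : ∀ k j → 1 + 2 * k + (1 + 2 * j) ≡ suc (k + j) + suc (k + j)
    halve = solve-∀

  prime-power-sum-even : ∀ {p} → Prime p → 2 < p → ∀ a b → ∃ λ h → p ^ a + p ^ b ≡ suc h + suc h
  prime-power-sum-even {p} p-prime 2<p a b = odd+odd (odd-^ p-odd a) (odd-^ p-odd b)
    where
    p-odd : Odd p
    p-odd = prime⇒odd p-prime 2<p

  jacobsthal : ℕ → ℕ
  jacobsthal zero          = 0
  jacobsthal (suc zero)    = 1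
  jacobsthal (suc (suc n)) = jacobsthal (suc n) + 2 * jacobsthal n

  jacobsthal-sum : ∀ n → jacobsthal (suc n) + jacobsthal n ≡ 2 ^ n
  jacobsthal-sum zero    = refl
  jacobsthal-sum (suc n) = begin
    jacobsthal (suc n) + 2 * jacobsthal n + jacobsthal (suc n)
      ≡⟨ regroup (jacobsthal (suc n)) (jacobsthal n) ⟩
    2 * (jacobsthal (suc n) + jacobsthal n) ≡⟨ cong (2 *_) (jacobsthal-sum n) ⟩
    2 * 2 ^ n                               ∎
    where
    regroup : ∀ a b → a + 2 * b + a ≡ 2 * (a + b)
    regroup = solve-∀

  jacobsthal-odd : ∀ m → jacobsthal (suc (m + m)) ≡ 1 + 2 * jacobsthal (m + m)
  jacobsthal-odd zero = refl
  jacobsthal-odd (suc m) rewrite +-suc m m | jacobsthal-odd m = step (jacobsthal (m + m))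
    where
    step : ∀ x → 1 + 2 * x + 2 * x + 2 * (1 + 2 * x) ≡ 1 + 2 * (1 + 2 * x + 2 * x)
    step = solve-∀

  jacobsthal-even : ∀ m → 3 * jacobsthal (m + m) + 1 ≡ 2 ^ (m + m)
  jacobsthal-even m = begin
    3 * x + 1                          ≡⟨ split x ⟩
    (1 + 2 * x) + x                    ≡⟨ cong (_+ x) (jacobsthal-odd m) ⟨
    jacobsthal (suc (m + m)) + x       ≡⟨ jacobsthal-sum (m + m) ⟩
    2 ^ (m + m)                        ∎
    where
    x : ℕ
    x = jacobsthal (m + m)
    split : ∀ x → 3 * x + 1 ≡ (1 + 2 * x) + x
    split = solve-∀

open Arithmetic

module FieldFacts {c ℓ : Level} (F : CommutativeRing c ℓ) where
  open CommutativeRing F renaming (_+_ to _+ᴿ_; _*_ to _*ᴿ_)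
  open import Relation.Binary.Reasoning.Setoid setoid
  open import Algebra.Properties.Ring ring
    using (-‿involutive; -‿distribˡ-*; -0#≈0#; +-cancelʳ; +-identityʳ-unique)
  open import Algebra.Properties.Semiring.Mult semiring using (_×_; ×-homo-+; ×1-homo-*)
  open import Algebra.Properties.CommutativeSemiring.Exp commutativeSemiring
    using (^-congˡ; ^-homo-*; ^-assocʳ; ^-distrib-*) renaming (_^_ to _^ᴿ_)
  open import Algebra.Properties.CommutativeMonoid.Sum +-commutativeMonoid
    using (sum; sum-permute; sum-cong-≋; ∑-distrib-+; sum-replicate)

  ι≡× : ∀ n → ι F n ≡.≡ n × 1#
  ι≡× zero    = ≡.refl
  ι≡× (suc n) = ≡.cong (1# +ᴿ_) (ι≡× n)

  ι-+ : ∀ m n → ι F (m + n) ≈ ι F m +ᴿ ι F n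
  ι-+ m n rewrite ι≡× (m + n) | ι≡× m | ι≡× n = ×-homo-+ 1# m n

  ι-* : ∀ m n → ι F (m * n) ≈ ι F m *ᴿ ι F n
  ι-* m n rewrite ι≡× (m * n) | ι≡× m | ι≡× n = ×1-homo-* m n

  ι-^ : ∀ m n → ι F (m ^ n) ≈ ι F m ^ᴿ n
  ι-^ m zero    = +-identityʳ 1#
  ι-^ m (suc n) = trans (ι-* m (m ^ n)) (*-congˡ (ι-^ m n))

  ι-mod : ∀ {s} → ι F s ≈ 0# → ∀ r q → ι F (r + q * s) ≈ ι F r
  ι-mod {s} ιs≈0 r q = begin
    ι F (r + q * s)           ≈⟨ ι-+ r (q * s) ⟩
    ι F r +ᴿ ι F (q * s)      ≈⟨ +-congˡ (ι-* q s) ⟩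
    ι F r +ᴿ ι F q *ᴿ ι F s   ≈⟨ +-congˡ (*-congˡ ιs≈0) ⟩
    ι F r +ᴿ ι F q *ᴿ 0#      ≈⟨ +-congˡ (zeroʳ (ι F q)) ⟩
    ι F r +ᴿ 0#               ≈⟨ +-identityʳ (ι F r) ⟩
    ι F r                     ∎

  -- A ring with N elements has characteristic dividing N: translation by 1 permutes
  -- the elements, so  Σ x = Σ (x + 1) = Σ x + N·1.
  characteristic : ∀ {N} → HasCard F N → ι F N ≈ 0#
  characteristic {N} card = begin
    ι F N     ≡⟨ ι≡× N ⟩
    N × 1#    ≈⟨ +-identityʳ-unique (sum to) (N × 1#) Σto+N≈Σto ⟩
    0#        ∎
    where
    open Inverse card

    translate-back : ∀ a b → a +ᴿ b ≈ 0# → ∀ i → from (to (from (to i +ᴿ a)) +ᴿ b) ≡.≡ i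
    translate-back a b a+b≈0 i = ≡.trans (from-cong (begin
      to (from (to i +ᴿ a)) +ᴿ b ≈⟨ +-congʳ (strictlyInverseˡ (to i +ᴿ a)) ⟩
      to i +ᴿ a +ᴿ b             ≈⟨ +-assoc (to i) a b ⟩
      to i +ᴿ (a +ᴿ b)           ≈⟨ +-congˡ a+b≈0 ⟩
      to i +ᴿ 0#                 ≈⟨ +-identityʳ (to i) ⟩
      to i                       ∎)) (strictlyInverseʳ i)

    translation : Permutation N N
    translation = permutation (λ i → from (to i +ᴿ 1#)) (λ i → from (to i +ᴿ - 1#))
      (translate-back (- 1#) 1# (-‿inverseˡ 1#)) (translate-back 1# (- 1#) (-‿inverseʳ 1#))

    Σto+N≈Σto : sum to +ᴿ N × 1# ≈ sum to
    Σto+N≈Σto = begin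
      sum to +ᴿ N × 1#                     ≈⟨ +-congˡ (sum-replicate N) ⟨
      sum to +ᴿ sum (replicate N 1#)       ≈⟨ ∑-distrib-+ to (replicate N 1#) ⟨
      sum (λ i → to i +ᴿ 1#)               ≈⟨ sum-cong-≋ (λ i → strictlyInverseˡ (to i +ᴿ 1#)) ⟨
      sum (λ i → to (from (to i +ᴿ 1#)))   ≈⟨ sum-permute to translation ⟨
      sum to                               ∎

  cancel-nonzero : IsField F → ∀ {a x y} → ¬ a ≈ 0# → a *ᴿ x ≈ a *ᴿ y → x ≈ y
  cancel-nonzero (_ , inverse) {a} {x} {y} a≉0 ax≈ay with inverse a a≉0
  ... | b , ab≈1 = begin
    x                ≈⟨ *-identityˡ x ⟨
    1# *ᴿ x          ≈⟨ *-congʳ (trans (*-comm b a) ab≈1) ⟨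
    b *ᴿ a *ᴿ x      ≈⟨ *-assoc b a x ⟩
    b *ᴿ (a *ᴿ x)    ≈⟨ *-congˡ ax≈ay ⟩
    b *ᴿ (a *ᴿ y)    ≈⟨ *-assoc b a y ⟨
    b *ᴿ a *ᴿ y      ≈⟨ *-congʳ (trans (*-comm b a) ab≈1) ⟩
    1# *ᴿ y          ≈⟨ *-identityˡ y ⟩
    y                ∎

  1^ : ∀ e → 1# ^ᴿ e ≈ 1#
  1^ zero    = refl
  1^ (suc e) = trans (*-identityˡ (1# ^ᴿ e)) (1^ e)

  -- A field has no nilpotents: xᵉ = 0 rules out x ≠ 0.  (Stated doubly negated,
  -- since equality in F need not be decidable.)
  no-nilpotents : IsField F → ∀ x e → x ^ᴿ e ≈ 0# → ¬ ¬ (x ≈ 0#)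
  no-nilpotents (1≉0 , inverse) x e xᵉ≈0 x≉0 with inverse x x≉0
  ... | y , xy≈1 = 1≉0 (begin
    1#                   ≈⟨ 1^ e ⟨
    1# ^ᴿ e              ≈⟨ ^-congˡ e xy≈1 ⟨
    (x *ᴿ y) ^ᴿ e        ≈⟨ ^-distrib-* x y e ⟩
    x ^ᴿ e *ᴿ y ^ᴿ e     ≈⟨ *-congʳ xᵉ≈0 ⟩
    0# *ᴿ y ^ᴿ e         ≈⟨ zeroˡ (y ^ᴿ e) ⟩
    0#                   ∎)

  field-characteristic : IsField F → ∀ p e → HasCard F (p ^ e) → ¬ ¬ (ι F p ≈ 0#)
  field-characteristic isField p e card =
    no-nilpotents isField (ι F p) e (trans (sym (ι-^ p e)) (characteristic card))

  bézout-collapse : ∀ {s t} → ι F s ≈ 0# → ι F t ≈ 0# → ∀ x y → 1 + y * s ≡.≡ x * t → 1# ≈ 0#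
  bézout-collapse {s} {t} ιs≈0 ιt≈0 x y eq = begin
    1#                ≈⟨ +-identityʳ 1# ⟨
    ι F 1             ≈⟨ ι-mod ιs≈0 1 y ⟨
    ι F (1 + y * s)   ≡⟨ ≡.cong (ι F) eq ⟩
    ι F (0 + x * t)   ≈⟨ ι-mod ιt≈0 0 x ⟩
    0#                ∎

  below-characteristic : IsField F → ∀ {p} → Prime p → ι F p ≈ 0# →
                         ∀ m → suc m < p → ¬ ι F (suc m) ≈ 0#
  below-characteristic (1≉0 , _) p-prime ιp≈0 m m<p ιm≈0
    with coprime-Bézout (prime⇒coprime p-prime m<p)
  ... | Bézout.+- x y eq = 1≉0 (bézout-collapse ιm≈0 ιp≈0 x y eq)
  ... | Bézout.-+ x y eq = 1≉0 (bézout-collapse ιp≈0 ιm≈0 y x eq)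

  two-frobenius : ∀ {p} → Prime p → ι F p ≈ 0# → ∀ a → ι F 2 ^ᴿ (p ^ a) ≈ ι F 2
  two-frobenius {p} p-prime ιp≈0 zero    = *-identityʳ (ι F 2)
  two-frobenius {p} p-prime ιp≈0 (suc a) = begin
    ι F 2 ^ᴿ (p * p ^ a)     ≈⟨ ^-assocʳ (ι F 2) p (p ^ a) ⟨
    (ι F 2 ^ᴿ p) ^ᴿ (p ^ a)  ≈⟨ ^-congˡ (p ^ a) two^p≈two ⟩
    ι F 2 ^ᴿ (p ^ a)         ≈⟨ two-frobenius p-prime ιp≈0 a ⟩
    ι F 2                    ∎
    where
    two^p≈two : ι F 2 ^ᴿ p ≈ ι F 2
    two^p≈two with fermat-two p-prime
    ... | k , 2ᵖ≡ = begin
      ι F 2 ^ᴿ p        ≈⟨ ι-^ 2 p ⟨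
      ι F (2 ^ p)       ≡⟨ ≡.cong (ι F) 2ᵖ≡ ⟩
      ι F (2 + k * p)   ≈⟨ ι-mod ιp≈0 2 k ⟩
      ι F 2             ∎

  D-at-zero : ∀ n → D F (suc n) 2 0# ≈ 1#
  D-at-zero zero    = refl
  D-at-zero (suc n) = begin
    D F (suc n) 2 0# - 0# *ᴿ D F n 2 0#   ≈⟨ +-congˡ (-‿cong (zeroˡ (D F n 2 0#))) ⟩
    D F (suc n) 2 0# - 0#                ≈⟨ +-congˡ -0#≈0# ⟩
    D F (suc n) 2 0# +ᴿ 0#               ≈⟨ +-identityʳ (D F (suc n) 2 0#) ⟩
    D F (suc n) 2 0#                     ≈⟨ D-at-zero n ⟩
    1#                                   ∎

  -- D_{n,2}(1,-2) is the image of the Jacobsthal number Jₙ: at x = -2 the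
  -- recurrence becomes Dₙ₊₂ = Dₙ₊₁ + 2 Dₙ.
  D-at-minus-two : ∀ n → D F n 2 (- ι F 2) ≈ ι F (jacobsthal n)
  D-at-minus-two zero          = -‿inverseʳ (ι F 2)
  D-at-minus-two (suc zero)    = sym (+-identityʳ 1#)
  D-at-minus-two (suc (suc n)) = begin
    D F (suc n) 2 x - x *ᴿ D F n 2 x          ≈⟨ +-congˡ (minus-minus (ι F 2) (D F n 2 x)) ⟩
    D F (suc n) 2 x +ᴿ ι F 2 *ᴿ D F n 2 x     ≈⟨ +-cong (D-at-minus-two (suc n)) (*-congˡ (D-at-minus-two n)) ⟩
    ι F J₁ +ᴿ ι F 2 *ᴿ ι F J₀                 ≈⟨ +-congˡ (ι-* 2 J₀) ⟨
    ι F J₁ +ᴿ ι F (2 * J₀)                    ≈⟨ ι-+ J₁ (2 * J₀) ⟨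
    ι F (J₁ + 2 * J₀)                         ∎
    where
    x : Carrier
    x = - ι F 2
    J₀ J₁ : ℕ
    J₀ = jacobsthal n
    J₁ = jacobsthal (suc n)
    minus-minus : ∀ a b → - (- a *ᴿ b) ≈ a *ᴿ b
    minus-minus a b = trans (-‿cong (sym (-‿distribˡ-* a b))) (-‿involutive (a *ᴿ b))

  D-at-minus-two-even : ∀ {n} m → n ≡.≡ m + m → ι F 3 *ᴿ D F n 2 (- ι F 2) +ᴿ ι F 1 ≈ ι F 2 ^ᴿ n
  D-at-minus-two-even m ≡.refl = begin
    ι F 3 *ᴿ D F (m + m) 2 (- ι F 2) +ᴿ ι F 1  ≈⟨ +-congʳ (*-congˡ (D-at-minus-two (m + m))) ⟩
    ι F 3 *ᴿ ι F J +ᴿ ι F 1                    ≈⟨ +-congʳ (ι-* 3 J) ⟨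
    ι F (3 * J) +ᴿ ι F 1                       ≈⟨ ι-+ (3 * J) 1 ⟨
    ι F (3 * J + 1)                            ≡⟨ ≡.cong (ι F) (jacobsthal-even m) ⟩
    ι F (2 ^ (m + m))                          ≈⟨ ι-^ 2 (m + m) ⟩
    ι F 2 ^ᴿ (m + m)                           ∎
    where
    J : ℕ
    J = jacobsthal (m + m)

  -- The heart of the argument: in characteristic p > 3, D_{pᵃ+pᵇ,2}(1,x) takes the
  -- value 1 both at x = 0 and at x = -2, because pᵃ + pᵇ is even and 2^(pᵃ+pᵇ) = 4.
  D-collision : IsField F → ∀ {p} → Prime p → 3 < p → ι F p ≈ 0# → ∀ a b →
                D F (p ^ a + p ^ b) 2 0# ≈ D F (p ^ a + p ^ b) 2 (- ι F 2)
  D-collision isField {p} p-prime 3<p ιp≈0 a b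
    with prime-power-sum-even p-prime (<-trans (n<1+n 2) 3<p) a b
  ... | h , n≡h+h = begin
    D F n 2 0#                  ≡⟨ ≡.cong (λ k → D F k 2 0#) n≡h+h ⟩
    D F (suc h + suc h) 2 0#    ≈⟨ D-at-zero (h + suc h) ⟩
    1#                          ≈⟨ +-identityʳ 1# ⟨
    ι F 1                       ≈⟨ D-at-minus-two≈1 ⟨
    D F n 2 (- ι F 2)           ∎
    where
    n : ℕ
    n = p ^ a + p ^ b
    three≉0 : ¬ ι F 3 ≈ 0#
    three≉0 = below-characteristic isField p-prime ιp≈0 2 3<p

    3D+1≈3+1 : ι F 3 *ᴿ D F n 2 (- ι F 2) +ᴿ ι F 1 ≈ ι F 3 *ᴿ ι F 1 +ᴿ ι F 1
    3D+1≈3+1 = begin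
      ι F 3 *ᴿ D F n 2 (- ι F 2) +ᴿ ι F 1    ≈⟨ D-at-minus-two-even (suc h) n≡h+h ⟩
      ι F 2 ^ᴿ (p ^ a + p ^ b)               ≈⟨ ^-homo-* (ι F 2) (p ^ a) (p ^ b) ⟩
      ι F 2 ^ᴿ (p ^ a) *ᴿ ι F 2 ^ᴿ (p ^ b)   ≈⟨ *-cong (two-frobenius p-prime ιp≈0 a)
                                                       (two-frobenius p-prime ιp≈0 b) ⟩
      ι F 2 *ᴿ ι F 2                         ≈⟨ ι-* 2 2 ⟨
      ι F (3 * 1 + 1)                        ≈⟨ ι-+ (3 * 1) 1 ⟩
      ι F (3 * 1) +ᴿ ι F 1                   ≈⟨ +-congʳ (ι-* 3 1) ⟩
      ι F 3 *ᴿ ι F 1 +ᴿ ι F 1                ∎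

    D-at-minus-two≈1 : D F n 2 (- ι F 2) ≈ ι F 1
    D-at-minus-two≈1 = cancel-nonzero isField three≉0 (+-cancelʳ (ι F 1) _ _ 3D+1≈3+1)

  zero≈-x⇒x≈0 : ∀ {x} → 0# ≈ - x → x ≈ 0#
  zero≈-x⇒x≈0 {x} 0≈-x = trans (sym (-‿involutive x)) (trans (-‿cong (sym 0≈-x)) -0#≈0#)

mainTheorem20 : {c ℓ : Level} (p e l₁ l₂ : ℕ) → Prime p → 3 < p → 1 ≤ e →
    (F : CommutativeRing c ℓ) → IsField F → HasCard F (p ^ e) →
    ¬ IsPermutation F (λ x → D F (p ^ l₁ + p ^ l₂) 2 x)
mainTheorem20 p e l₁ l₂ p-prime 3<p _ F isField card (injective , _) =
  field-characteristic isField p e card λ ιp≈0 →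
    two≉0 ιp≈0 (zero≈-x⇒x≈0 (injective 0# (- ι F 2)
                               (D-collision isField p-prime 3<p ιp≈0 l₁ l₂)))
  where
  open CommutativeRing F using (_≈_; 0#; -_)
  open FieldFacts F
  two≉0 : ι F p ≈ 0# → ¬ ι F 2 ≈ 0#
  two≉0 ιp≈0 = below-characteristic isField p-prime ιp≈0 1 (<-trans (n<1+n 2) 3<p)
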